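{- Let $G=G_1\oplus G_2$ be a finite abelian group, where $G_1,G_2\subset G$ are nontrivial subgroups with $\mathsf D(G_1)\le\mathsf D(G_2)$. Then $\rho_3(G)\ge 2\mathsf D(G_1)+\mathsf D(G_2)-2$ with spread $X\in\mathcal F(\{2,3\})$ having $\mathsf v_3(X)=1$.
   Context: For a finite abelian group $G$, sequences over $G$ are elements of the free abelian monoid $\mathcal F(G)$ (finite unordered lists with repetition), $\mathcal B(G)$ is the monoid of zero-sum sequences, and its atoms $\mathcal A(G)$ are the minimal zero-sum sequences; $\mathsf D(G)$ is the maximal length of an atom. For $\omega\in\mathbb N$ and $X\in\mathcal F(\mathbb Z)$ (a finite multiset of integers), "$\rho_3(G)\ge\omega$ with spread $X$" means: there exist atoms $U_1,U_2,U_3,W_1,\dots,W_\rho\in\mathcal A(G)$ with $U_1U_2U_3=W_1\cdots W_\rho$ and $\rho\ge\omega$, together with subsequences $T_{i,j}\mid U_j$ ($i\in[1,\rho]$, $j\in[1,3]$) such that $W_i=T_{i,1}T_{i,2}T_{i,3}$ for all $i$ and $\prod_{i=1}^\rho T_{i,j}=U_j$ for all $j$, and $X=\prod_{i=1}^\rho x_i$ where $x_i$ is the number of $j\in[1,3]$ with $T_{i,j}$ nonempty. $X\in\mathcal F(\{2,3\})$ means every entry of $X$ is $2$ or $3$, and $\mathsf v_3(X)$ is the number of entries equal to $3$. -}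

module Defs where

open import Level using (Level; _⊔_; suc)
open import Algebra.Bundles using (AbelianGroup)
open import Data.Nat using (ℕ; _≤_; _≡ᵇ_)
open import Data.Bool using (Bool; true; false; if_then_else_)
open import Data.List using (List; []; _∷_; foldr; length; concat; map; _++_)
open import Data.List.Relation.Unary.All using (All)
open import Data.List.Relation.Unary.Any using (Any)
open import Data.List.Relation.Binary.Sublist.Propositional using (_⊆_)
import Data.List.Relation.Binary.Permutation.Setoid as PermS
open import Data.Product using (Σ; ∃; _×_)
open import Relation.Binary.PropositionalEquality using (_≡_)
open import Relation.Nullary using (¬_)

-- Sequences over G are finite lists of elements of G; the order is irrelevant,
-- so equality of sequences (as elements of the free abelian monoid F(G)) is
-- "permutation up to the group's setoid equality", and a subsequence T | S is
-- represented by a sublist of S.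

module _ {c ℓ : Level} (G : AbelianGroup c ℓ) where
  open AbelianGroup G

  σ : List Carrier → Carrier
  σ = foldr _∙_ ε

  IsFiniteGroup : Set (c ⊔ ℓ)
  IsFiniteGroup = Σ (List Carrier) λ enum → ∀ x → Any (x ≈_) enum

  record Subgroup (p : Level) : Set (c ⊔ ℓ ⊔ suc p) where
    field
      mem   : Carrier → Set p
      resp  : ∀ {x y} → x ≈ y → mem x → mem y
      ε-mem : mem ε
      ∙-mem : ∀ {x y} → mem x → mem y → mem (x ∙ y)
      ⁻¹-mem : ∀ {x} → mem x → mem (x ⁻¹)
  open Subgroup public

  Nontrivial : ∀ {p} → Subgroup p → Set (c ⊔ ℓ ⊔ p)
  Nontrivial H = Σ Carrier λ x → mem H x × ¬ (x ≈ ε)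

  IsDirectSum : ∀ {p} → Subgroup p → Subgroup p → Set (c ⊔ ℓ ⊔ p)
  IsDirectSum H₁ H₂ =
    (∀ g → Σ Carrier λ a → Σ Carrier λ b → mem H₁ a × mem H₂ b × (g ≈ a ∙ b))
    × (∀ x → mem H₁ x → mem H₂ x → x ≈ ε)

  ZeroSum : List Carrier → Set ℓ
  ZeroSum S = σ S ≈ ε

  IsAtom : List Carrier → Set (c ⊔ ℓ)
  IsAtom S = ¬ (S ≡ []) × ZeroSum S ×
    (∀ T → T ⊆ S → ¬ (T ≡ []) → ZeroSum T → length T ≡ length S)

  IsDavenport : ∀ {p} → Subgroup p → ℕ → Set (c ⊔ ℓ ⊔ p)
  IsDavenport H d =
    (Σ (List Carrier) λ S → IsAtom S × All (mem H) S × length S ≡ d)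
    × (∀ S → IsAtom S → All (mem H) S → length S ≤ d)

  _≋_ : List Carrier → List Carrier → Set (c ⊔ ℓ)
  _≋_ = PermS._↭_ setoid

  record Triple : Set c where
    constructor ⟨_,_,_⟩
    field
      t₁ t₂ t₃ : List Carrier

  Wof : Triple → List Carrier
  Wof ⟨ a , b , d ⟩ = a ++ b ++ d

  nonempty? : List Carrier → ℕ
  nonempty? [] = 0
  nonempty? (_ ∷ _) = 1

  spreadOf : Triple → ℕ
  spreadOf ⟨ a , b , d ⟩ = nonempty? a Data.Nat.+ nonempty? b Data.Nat.+ nonempty? d

  -- "ρ₃(G) ≥ ω with spread X" : witnessed by atoms U₁U₂U₃ and a list of ρ
  -- triples, and X is the returned list of spreads
  Rho3WithSpread : ℕ → List ℕ → Set (c ⊔ ℓ)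
  Rho3WithSpread ω X =
    Σ (List Carrier) λ U₁ → Σ (List Carrier) λ U₂ → Σ (List Carrier) λ U₃ →
    Σ (List Triple) λ Ts →
      IsAtom U₁ × IsAtom U₂ × IsAtom U₃
      × All (λ t → IsAtom (Wof t)) Ts
      × (concat (map Triple.t₁ Ts) ≋ U₁)
      × (concat (map Triple.t₂ Ts) ≋ U₂)
      × (concat (map Triple.t₃ Ts) ≋ U₃)
      × (ω ≤ length Ts)
      × (X ≡ map spreadOf Ts)

v₃ : List ℕ → ℕ
v₃ [] = 0
v₃ (x ∷ xs) = (if x ≡ᵇ 3 then 1 else 0) Data.Nat.+ v₃ xs

In23 : List ℕ → Set
In23 X = All (λ x → (x ≡ 2) Data.Sum.⊎ (x ≡ 3)) X
  where import Data.Sum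

module Submission where

-- Take atoms a·A and b·B of maximal length over G₁ and G₂, write A = a₂⋯aₙ, and pair aᵢ with
-- the i-th term bᵢ of B (possible as |A| ≤ |B|). With
--   L₁ = A·B,   L₂ = (−A)·∏(−aᵢ + bᵢ),   L₃ = (−B)·∏(−bᵢ + aᵢ),   Uⱼ = (−σ(Lⱼ))·Lⱼ,
-- each Uⱼ is an atom: w·L is an atom as soon as it is zero-sum, L is zero-sum free and no
-- proper subsequence of L has the sum σ(L), and both properties pass from A and B to the Lⱼ
-- by splitting sums into their G₁- and G₂-components. U₁U₂U₃ factors into the atoms
-- a(−a), b(−b), (−aᵢ + bᵢ)(−bᵢ + aᵢ) and the three heads, i.e. into
-- |A| + |B| + |A| + 1 = 2D(G₁) + D(G₂) − 2 atoms, exactly one of which meets all three Uⱼ.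

open import Defs
open import Level using (Level; _⊔_)
open import Algebra.Bundles using (AbelianGroup)
open import Data.Nat using (ℕ; suc; _+_; _*_; _∸_; _≤_; s≤s)
open import Data.Nat.Properties using (≤-reflexive; n≮n; suc-injective)
open import Data.Product using (Σ; ∃; ∃₂; _×_; _,_; proj₁; proj₂)
open import Data.Sum using (inj₁; inj₂)
open import Data.Empty using (⊥-elim)
open import Function using (_∘_)
open import Data.Nat.Tactic.RingSolver using (solve-∀)
open import Data.List using (List; []; _∷_; _++_; map; length; zip; drop; concat; concatMap)
open import Data.List.Properties
  using (length-map; length-++; ++-cancelʳ; ++-conicalˡ; ++-conicalʳ; ++-identityʳ;
         concatMap-++; concatMap-map; concatMap-pure)
open import Data.List.Relation.Unary.All as All using (All; []; _∷_)
import Data.List.Relation.Unary.All.Properties as All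
open import Data.List.Relation.Binary.Sublist.Propositional
  using (_⊆_; []; _∷_; _∷ʳ_; ⊆-refl; ⊆-trans; from∈)
open import Data.List.Relation.Binary.Sublist.Propositional.Properties
  using (length-mono-≤; to-≋; map⁺; ++⁺; ++⁺ʳ; All-resp-⊆)
open import Data.List.Relation.Binary.Equality.Propositional using (≋⇒≡)
open import Relation.Nullary using (¬_)
open import Relation.Binary.PropositionalEquality as ≡ using (_≡_; _≢_; refl; cong; subst)

private
  variable
    a b : Level
    A : Set a
    B : Set b

⊆-++⁻ : ∀ (xs : List A) {ys zs} → zs ⊆ xs ++ ys →
        ∃₂ λ zs₁ zs₂ → zs ≡ zs₁ ++ zs₂ × zs₁ ⊆ xs × zs₂ ⊆ ys
⊆-++⁻ []       τ          = [] , _ , refl , [] , τ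
⊆-++⁻ (x ∷ xs) (.x ∷ʳ τ)  with ⊆-++⁻ xs τ
... | zs₁ , zs₂ , refl , τ₁ , τ₂ = zs₁ , zs₂ , refl , x ∷ʳ τ₁ , τ₂
⊆-++⁻ (x ∷ xs) (refl ∷ τ) with ⊆-++⁻ xs τ
... | zs₁ , zs₂ , refl , τ₁ , τ₂ = x ∷ zs₁ , zs₂ , refl , refl ∷ τ₁ , τ₂

⊆-map⁻ : (f : A → B) {xs : List A} {ys : List B} → ys ⊆ map f xs →
         ∃ λ zs → ys ≡ map f zs × zs ⊆ xs
⊆-map⁻ f {[]}     []         = [] , refl , []
⊆-map⁻ f {x ∷ xs} (_ ∷ʳ τ)   with ⊆-map⁻ f τ
... | zs , refl , τ′ = zs , refl , x ∷ʳ τ′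
⊆-map⁻ f {x ∷ xs} (refl ∷ τ) with ⊆-map⁻ f τ
... | zs , refl , τ′ = x ∷ zs , refl , refl ∷ τ′

⊆-length⇒≡ : {xs ys : List A} → xs ⊆ ys → length xs ≡ length ys → xs ≡ ys
⊆-length⇒≡ τ eq = ≋⇒≡ (to-≋ eq τ)

map≡[]⇒≡[] : (f : A → B) {xs : List A} → map f xs ≡ [] → xs ≡ []
map≡[]⇒≡[] f {[]} _ = refl

map-proj₁-zip : {xs : List A} {ys : List B} → length xs ≤ length ys → map proj₁ (zip xs ys) ≡ xs
map-proj₁-zip {xs = []}                  _       = refl
map-proj₁-zip {xs = x ∷ xs} {ys = _ ∷ _} (s≤s le) = cong (x ∷_) (map-proj₁-zip le)

map-proj₂-zip-++-drop : (xs : List A) {ys : List B} → length xs ≤ length ys →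
                        map proj₂ (zip xs ys) ++ drop (length xs) ys ≡ ys
map-proj₂-zip-++-drop []                       _       = refl
map-proj₂-zip-++-drop (_ ∷ xs) {ys = y ∷ _} (s≤s le) = cong (y ∷_) (map-proj₂-zip-++-drop xs le)

concatMap-singleton : (f : A → B) (xs : List A) → concatMap (λ x → f x ∷ []) xs ≡ map f xs
concatMap-singleton f []       = refl
concatMap-singleton f (x ∷ xs) = cong (f x ∷_) (concatMap-singleton f xs)

concatMap-[] : (xs : List A) → concatMap {B = B} (λ _ → []) xs ≡ []
concatMap-[] []       = refl
concatMap-[] (x ∷ xs) = concatMap-[] xs

all-2⇒v₃≡0 : ∀ {xs} → All (_≡ 2) xs → v₃ xs ≡ 0
all-2⇒v₃≡0 []         = refl
all-2⇒v₃≡0 (refl ∷ ps) = all-2⇒v₃≡0 ps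

3∷all-2⇒In23×v₃≡1 : ∀ {xs} → All (_≡ 2) xs → In23 (3 ∷ xs) × v₃ (3 ∷ xs) ≡ 1
3∷all-2⇒In23×v₃≡1 ps = inj₂ refl ∷ All.map inj₁ ps , cong suc (all-2⇒v₃≡0 ps)

module Sequences {c ℓ : Level} (G : AbelianGroup c ℓ) where

  open AbelianGroup G renaming (refl to ≈-refl)
  open import Algebra.Properties.AbelianGroup G
  open import Algebra.Properties.CommutativeSemigroup commutativeSemigroup using (interchange)

  σ-++ : ∀ xs ys → σ G (xs ++ ys) ≈ σ G xs ∙ σ G ys
  σ-++ []       ys = sym (identityˡ _)
  σ-++ (x ∷ xs) ys = trans (∙-congˡ (σ-++ xs ys)) (sym (assoc _ _ _))

  σ-map-⁻¹ : ∀ xs → σ G (map _⁻¹ xs) ≈ σ G xs ⁻¹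
  σ-map-⁻¹ []       = sym ε⁻¹≈ε
  σ-map-⁻¹ (x ∷ xs) = trans (∙-congˡ (σ-map-⁻¹ xs)) (⁻¹-∙-comm x _)

  σ-map-∙ : (f g : A → Carrier) (xs : List A) →
            σ G (map (λ x → f x ∙ g x) xs) ≈ σ G (map f xs) ∙ σ G (map g xs)
  σ-map-∙ f g []       = sym (identityˡ ε)
  σ-map-∙ f g (x ∷ xs) = trans (∙-congˡ (σ-map-∙ f g xs)) (interchange _ _ _ _)

  σ-concat-zeroSum : {xss : List (List Carrier)} → All (ZeroSum G) xss → σ G (concat xss) ≈ ε
  σ-concat-zeroSum []                    = ≈-refl
  σ-concat-zeroSum {xs ∷ xss} (z ∷ zs) =
    trans (σ-++ xs (concat xss)) (trans (∙-cong z (σ-concat-zeroSum zs)) (identityˡ ε))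

  σ-concatMap-Wof : ∀ ts → σ G (concatMap (Wof G) ts) ≈
    σ G (concatMap Triple.t₁ ts) ∙ (σ G (concatMap Triple.t₂ ts) ∙ σ G (concatMap Triple.t₃ ts))
  σ-concatMap-Wof []                    = sym (trans (∙-congˡ (identityˡ ε)) (identityˡ ε))
  σ-concatMap-Wof (⟨ r , s , t ⟩ ∷ ts) = begin
    σ G ((r ++ s ++ t) ++ concatMap (Wof G) ts)
      ≈⟨ σ-++ (r ++ s ++ t) _ ⟩
    σ G (r ++ s ++ t) ∙ σ G (concatMap (Wof G) ts)
      ≈⟨ ∙-cong (trans (σ-++ r _) (∙-congˡ (σ-++ s t))) (σ-concatMap-Wof ts) ⟩
    (σ G r ∙ (σ G s ∙ σ G t)) ∙ (R ∙ (S ∙ T))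
      ≈⟨ trans (interchange _ _ _ _) (∙-congˡ (interchange _ _ _ _)) ⟩
    (σ G r ∙ R) ∙ ((σ G s ∙ S) ∙ (σ G t ∙ T))
      ≈⟨ sym (∙-cong (σ-++ r _) (∙-cong (σ-++ s _) (σ-++ t _))) ⟩
    σ G (r ++ concatMap Triple.t₁ ts) ∙
      (σ G (s ++ concatMap Triple.t₂ ts) ∙ σ G (t ++ concatMap Triple.t₃ ts)) ∎
    where
    open import Relation.Binary.Reasoning.Setoid setoid
    R = σ G (concatMap Triple.t₁ ts)
    S = σ G (concatMap Triple.t₂ ts)
    T = σ G (concatMap Triple.t₃ ts)

  σ-mem : ∀ {p} (H : Subgroup G p) {xs} → All (mem H) xs → mem H (σ G xs)
  σ-mem H []       = ε-mem H
  σ-mem H (h ∷ hs) = ∙-mem H h (σ-mem H hs)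

  ZeroSumFree : List Carrier → Set (c ⊔ ℓ)
  ZeroSumFree xs = ∀ {ys} → ys ⊆ xs → ZeroSum G ys → ys ≡ []

  SumDetermined : List Carrier → Set (c ⊔ ℓ)
  SumDetermined xs = ∀ {ys} → ys ⊆ xs → σ G ys ≈ σ G xs → ys ≡ xs

  ⁻¹≈ε⇒≈ε : ∀ {x} → x ⁻¹ ≈ ε → x ≈ ε
  ⁻¹≈ε⇒≈ε e = ⁻¹-injective (trans e (sym ε⁻¹≈ε))

  ∙ε≈ε⇒≈ε : ∀ {x} → x ∙ ε ≈ ε → x ≈ ε
  ∙ε≈ε⇒≈ε e = trans (sym (identityʳ _)) e

  zeroSumFree-⊆ : ∀ {xs ys} → xs ⊆ ys → ZeroSumFree ys → ZeroSumFree xs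
  zeroSumFree-⊆ τ free τ′ = free (⊆-trans τ′ τ)

  zeroSumFree⇒nonzero : ∀ {xs} → ZeroSumFree xs → All (λ x → ¬ x ≈ ε) xs
  zeroSumFree⇒nonzero free =
    All.tabulate λ {x} x∈xs x≈ε → ∷≢[] (free {x ∷ []} (from∈ x∈xs) (trans (identityʳ x) x≈ε))
    where
    ∷≢[] : ∀ {x : Carrier} → _≢_ {A = List Carrier} (x ∷ []) []
    ∷≢[] ()

  ⁻¹σ≉ε : ∀ {xs} → ZeroSumFree xs → xs ≢ [] → ¬ σ G xs ⁻¹ ≈ ε
  ⁻¹σ≉ε free xs≢[] e = xs≢[] (free ⊆-refl (⁻¹≈ε⇒≈ε e))

  zeroSumFree-map⁻¹ : ∀ {xs} → ZeroSumFree xs → ZeroSumFree (map _⁻¹ xs)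
  zeroSumFree-map⁻¹ free τ z with ⊆-map⁻ _⁻¹ τ
  ... | ys , refl , τ′ = cong (map _⁻¹) (free τ′ (⁻¹≈ε⇒≈ε (trans (sym (σ-map-⁻¹ ys)) z)))

  sumDetermined-map⁻¹ : ∀ {xs} → SumDetermined xs → SumDetermined (map _⁻¹ xs)
  sumDetermined-map⁻¹ {xs} det τ eq with ⊆-map⁻ _⁻¹ τ
  ... | ys , refl , τ′ =
    cong (map _⁻¹) (det τ′ (⁻¹-injective (trans (sym (σ-map-⁻¹ ys)) (trans eq (σ-map-⁻¹ xs)))))

  sumDetermined-++ˡ : ∀ {xs} ys → SumDetermined (xs ++ ys) → SumDetermined xs
  sumDetermined-++ˡ {xs} ys det {zs} τ eq = ++-cancelʳ ys zs xs (det (++⁺ τ ⊆-refl)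
    (trans (σ-++ zs ys) (trans (∙-congʳ eq) (sym (σ-++ xs ys)))))

  zeroSumFree-[x] : ∀ {x} → ¬ x ≈ ε → ZeroSumFree (x ∷ [])
  zeroSumFree-[x] x≉ε (_ ∷ʳ [])   _ = refl
  zeroSumFree-[x] x≉ε (refl ∷ []) z = ⊥-elim (x≉ε (∙ε≈ε⇒≈ε z))

  sumDetermined-[x] : ∀ {x} → ¬ x ≈ ε → SumDetermined (x ∷ [])
  sumDetermined-[x] x≉ε (_ ∷ʳ [])   eq = ⊥-elim (x≉ε (∙ε≈ε⇒≈ε (sym eq)))
  sumDetermined-[x] x≉ε (refl ∷ []) _  = refl

  atom-∷ : ∀ {w xs} → ZeroSum G (w ∷ xs) → ZeroSumFree xs → SumDetermined xs → IsAtom G (w ∷ xs)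
  atom-∷ {w} {xs} z free det = (λ ()) , z , minimal
    where
    minimal : ∀ ys → ys ⊆ w ∷ xs → ys ≢ [] → ZeroSum G ys → length ys ≡ suc (length xs)
    minimal ys       (_ ∷ʳ τ)   ys≢[] z′ = ⊥-elim (ys≢[] (free τ z′))
    minimal (_ ∷ ys) (refl ∷ τ) _     z′ =
      cong (suc ∘ length) (det τ (trans (inverseʳ-unique w _ z′) (sym (inverseʳ-unique w _ z))))

  atom⇒zeroSumFree : ∀ {w xs} → IsAtom G (w ∷ xs) → ZeroSumFree xs
  atom⇒zeroSumFree                      _                 {[]}     _ _ = refl
  atom⇒zeroSumFree {w} {xs} (_ , _ , minimal) {y ∷ ys} τ z =
    ⊥-elim (n≮n (length xs)
      (subst (_≤ length xs) (minimal (y ∷ ys) (w ∷ʳ τ) (λ ()) z) (length-mono-≤ τ)))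

  atom⇒sumDetermined : ∀ {w xs} → IsAtom G (w ∷ xs) → SumDetermined xs
  atom⇒sumDetermined {w} (_ , z , minimal) {ys} τ eq =
    ⊆-length⇒≡ τ (suc-injective (minimal (w ∷ ys) (refl ∷ τ) (λ ()) (trans (∙-congˡ eq) z)))

  atom-pair : ∀ {x y} → ZeroSum G (x ∷ y ∷ []) → ¬ x ≈ ε → IsAtom G (x ∷ y ∷ [])
  atom-pair {x} {y} z x≉ε = atom-∷ z (zeroSumFree-[x] y≉ε) (sumDetermined-[x] y≉ε)
    where
    y≉ε : ¬ y ≈ ε
    y≉ε y≈ε = x≉ε (∙ε≈ε⇒≈ε (trans (∙-congˡ (sym (trans (identityʳ y) y≈ε))) z))

  atom-inverse-pair : ∀ {x} → ¬ x ≈ ε → IsAtom G (x ∷ x ⁻¹ ∷ [])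
  atom-inverse-pair {x} = atom-pair (trans (∙-congˡ (identityʳ _)) (inverseʳ x))

  atom-triple : ∀ {x y z} → ZeroSum G (x ∷ y ∷ z ∷ []) →
                ¬ x ≈ ε → ¬ y ≈ ε → ¬ z ≈ ε → IsAtom G (x ∷ y ∷ z ∷ [])
  atom-triple {x} {y} {z} s x≉ε y≉ε z≉ε = atom-∷ s free det
    where
    yz≉ε : ¬ y ∙ (z ∙ ε) ≈ ε
    yz≉ε e = x≉ε (trans (inverseˡ-unique x _ s) (trans (⁻¹-cong e) ε⁻¹≈ε))
    free : ZeroSumFree (y ∷ z ∷ [])
    free (_ ∷ʳ _ ∷ʳ [])     _ = refl
    free (_ ∷ʳ refl ∷ [])   e = ⊥-elim (z≉ε (∙ε≈ε⇒≈ε e))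
    free (refl ∷ _ ∷ʳ [])   e = ⊥-elim (y≉ε (∙ε≈ε⇒≈ε e))
    free (refl ∷ refl ∷ []) e = ⊥-elim (yz≉ε e)
    det : SumDetermined (y ∷ z ∷ [])
    det (_ ∷ʳ _ ∷ʳ [])     e = ⊥-elim (yz≉ε (sym e))
    det (_ ∷ʳ refl ∷ [])   e = ⊥-elim (y≉ε (sym (∙-cancelʳ (z ∙ ε) ε y (trans (identityˡ _) e))))
    det (refl ∷ _ ∷ʳ [])   e = ⊥-elim (z≉ε (∙ε≈ε⇒≈ε (sym (∙-cancelˡ y ε (z ∙ ε) e))))
    det (refl ∷ refl ∷ []) _ = refl

module DirectSum {c ℓ p : Level} (G : AbelianGroup c ℓ) (H K : Subgroup G p)
  (independent : ∀ x → mem H x → mem K x → AbelianGroup._≈_ G x (AbelianGroup.ε G)) where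

  open AbelianGroup G hiding (refl)
  open import Algebra.Properties.AbelianGroup G
  open import Algebra.Properties.CommutativeSemigroup commutativeSemigroup using (interchange)
  open Sequences G

  components-zero : ∀ {u v} → mem H u → mem K v → u ∙ v ≈ ε → u ≈ ε × v ≈ ε
  components-zero {u} {v} u∈H v∈K e = u≈ε , v≈ε
    where
    u≈ε : u ≈ ε
    u≈ε = independent u u∈H (resp K (sym (inverseˡ-unique u v e)) (⁻¹-mem K v∈K))
    v≈ε : v ≈ ε
    v≈ε = trans (inverseʳ-unique u v e) (trans (⁻¹-cong u≈ε) ε⁻¹≈ε)

  components-unique : ∀ {u v u′ v′} → mem H u → mem K v → mem H u′ → mem K v′ →
                      u ∙ v ≈ u′ ∙ v′ → u ≈ u′ × v ≈ v′
  components-unique {u} {v} {u′} {v′} u∈H v∈K u′∈H v′∈K e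
    with components-zero (∙-mem H u∈H (⁻¹-mem H u′∈H)) (∙-mem K v∈K (⁻¹-mem K v′∈K)) difference≈ε
    where
    difference≈ε : (u ∙ u′ ⁻¹) ∙ (v ∙ v′ ⁻¹) ≈ ε
    difference≈ε = trans (interchange _ _ _ _) (trans (∙-congˡ (⁻¹-∙-comm u′ v′)) (x≈y⇒x∙y⁻¹≈ε e))
  ... | e₁ , e₂ = x∙y⁻¹≈ε⇒x≈y u u′ e₁ , x∙y⁻¹≈ε⇒x≈y v v′ e₂

  private
    σ-⊆-mem : ∀ (L : Subgroup G p) {xs ys} → ys ⊆ xs → All (mem L) xs → mem L (σ G ys)
    σ-⊆-mem L τ xs∈L = σ-mem L (All-resp-⊆ τ xs∈L)

  zeroSumFree-++ : ∀ {xs ys} → All (mem H) xs → All (mem K) ys →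
                   ZeroSumFree xs → ZeroSumFree ys → ZeroSumFree (xs ++ ys)
  zeroSumFree-++ {xs} xs∈H ys∈K xs-free ys-free τ z with ⊆-++⁻ xs τ
  ... | zs₁ , zs₂ , refl , τ₁ , τ₂
    with components-zero (σ-⊆-mem H τ₁ xs∈H) (σ-⊆-mem K τ₂ ys∈K) (trans (sym (σ-++ zs₁ zs₂)) z)
  ... | z₁ , z₂ rewrite xs-free τ₁ z₁ | ys-free τ₂ z₂ = refl

  sumDetermined-++ : ∀ {xs ys} → All (mem H) xs → All (mem K) ys →
                     SumDetermined xs → SumDetermined ys → SumDetermined (xs ++ ys)
  sumDetermined-++ {xs} {ys} xs∈H ys∈K xs-det ys-det τ eq with ⊆-++⁻ xs τ
  ... | zs₁ , zs₂ , refl , τ₁ , τ₂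
    with components-unique (σ-⊆-mem H τ₁ xs∈H) (σ-⊆-mem K τ₂ ys∈K) (σ-mem H xs∈H) (σ-mem K ys∈K)
           (trans (sym (σ-++ zs₁ zs₂)) (trans eq (σ-++ xs ys)))
  ... | e₁ , e₂ = ≡.cong₂ _++_ (xs-det τ₁ e₁) (ys-det τ₂ e₂)

  module _ {a} {A : Set a} (u v : A → Carrier) where

    private
      σ-split : ∀ xs ps →
        σ G (xs ++ map (λ q → u q ∙ v q) ps) ≈ (σ G xs ∙ σ G (map u ps)) ∙ σ G (map v ps)
      σ-split xs ps = trans (σ-++ xs _) (trans (∙-congˡ (σ-map-∙ u v ps)) (sym (assoc _ _ _)))

    zeroSumFree-++-map-∙ : ∀ {xs ps} → All (mem H) xs → All (mem H ∘ u) ps → All (mem K ∘ v) ps →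
      ZeroSumFree xs → ZeroSumFree (map v ps) → ZeroSumFree (xs ++ map (λ q → u q ∙ v q) ps)
    zeroSumFree-++-map-∙ {xs} xs∈H u∈H v∈K xs-free v-free τ z with ⊆-++⁻ xs τ
    ... | ys , _ , refl , τ₁ , τ₂ with ⊆-map⁻ (λ q → u q ∙ v q) τ₂
    ... | ps′ , refl , ρ
      with components-zero (∙-mem H (σ-⊆-mem H τ₁ xs∈H) (σ-⊆-mem H (map⁺ u ρ) (All.map⁺ u∈H)))
                           (σ-⊆-mem K (map⁺ v ρ) (All.map⁺ v∈K)) (trans (sym (σ-split ys ps′)) z)
    ... | z₁ , z₂ with map≡[]⇒≡[] v (v-free (map⁺ v ρ) z₂)
    ... | refl rewrite xs-free τ₁ (∙ε≈ε⇒≈ε z₁) = refl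

    sumDetermined-++-map-∙ : ∀ {xs ps} → All (mem H) xs → All (mem H ∘ u) ps → All (mem K ∘ v) ps →
      SumDetermined xs → SumDetermined (map v ps) → SumDetermined (xs ++ map (λ q → u q ∙ v q) ps)
    sumDetermined-++-map-∙ {xs} {ps} xs∈H u∈H v∈K xs-det v-det τ eq with ⊆-++⁻ xs τ
    ... | ys , _ , refl , τ₁ , τ₂ with ⊆-map⁻ (λ q → u q ∙ v q) τ₂
    ... | ps′ , refl , ρ
      with components-unique (∙-mem H (σ-⊆-mem H τ₁ xs∈H) (σ-⊆-mem H (map⁺ u ρ) (All.map⁺ u∈H)))
                             (σ-⊆-mem K (map⁺ v ρ) (All.map⁺ v∈K))
                             (∙-mem H (σ-mem H xs∈H) (σ-mem H (All.map⁺ u∈H))) (σ-mem K (All.map⁺ v∈K))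
                             (trans (sym (σ-split ys ps′)) (trans eq (σ-split xs ps)))
    ... | e₁ , e₂ with ⊆-length⇒≡ ρ (length-map⁻ (v-det (map⁺ v ρ) e₂))
      where
      length-map⁻ : map v ps′ ≡ map v ps → length ps′ ≡ length ps
      length-map⁻ eq′ = ≡.trans (≡.sym (length-map v ps′)) (≡.trans (cong length eq′) (length-map v ps))
    ... | refl = cong (_++ _) (xs-det τ₁ (∙-cancelʳ _ _ _ e₁))

module Construction {c ℓ p : Level} (G : AbelianGroup c ℓ) (G₁ G₂ : Subgroup G p)
  (independent : ∀ x → mem G₁ x → mem G₂ x → AbelianGroup._≈_ G x (AbelianGroup.ε G))
  {a b : AbelianGroup.Carrier G} {as bs : List (AbelianGroup.Carrier G)}
  (A-atom : IsAtom G (a ∷ as)) (as∈G₁ : All (mem G₁) as)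
  (B-atom : IsAtom G (b ∷ bs)) (bs∈G₂ : All (mem G₂) bs)
  (as≢[] : as ≢ []) (as≤bs : length as ≤ length bs) where

  open AbelianGroup G hiding (refl)
  open import Algebra.Properties.AbelianGroup G
  open Sequences G
  module D₁₂ = DirectSum G G₁ G₂ independent
  module D₂₁ = DirectSum G G₂ G₁ (λ x x∈G₂ x∈G₁ → independent x x∈G₁ x∈G₂)

  Q : List (Carrier × Carrier)
  Q = zip as bs

  Q₁≡as : map proj₁ Q ≡ as
  Q₁≡as = map-proj₁-zip as≤bs

  Q₂++drop≡bs : map proj₂ Q ++ drop (length as) bs ≡ bs
  Q₂++drop≡bs = map-proj₂-zip-++-drop as as≤bs

  k₂ k₃ : Carrier × Carrier → Carrier
  k₂ q = proj₁ q ⁻¹ ∙ proj₂ q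
  k₃ q = proj₂ q ⁻¹ ∙ proj₁ q

  L₁ L₂ L₃ : List Carrier
  L₁ = as ++ bs
  L₂ = map _⁻¹ as ++ map k₂ Q
  L₃ = map _⁻¹ bs ++ map k₃ Q

  U₁ U₂ U₃ : List Carrier
  U₁ = σ G L₁ ⁻¹ ∷ L₁
  U₂ = σ G L₂ ⁻¹ ∷ L₂
  U₃ = σ G L₃ ⁻¹ ∷ L₃

  as-free : ZeroSumFree as
  as-free = atom⇒zeroSumFree A-atom
  bs-free : ZeroSumFree bs
  bs-free = atom⇒zeroSumFree B-atom
  as-det : SumDetermined as
  as-det = atom⇒sumDetermined A-atom
  bs-det : SumDetermined bs
  bs-det = atom⇒sumDetermined B-atom

  Q₁∈G₁ : All (mem G₁ ∘ proj₁) Q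
  Q₁∈G₁ = All.map⁻ (subst (All (mem G₁)) (≡.sym Q₁≡as) as∈G₁)
  Q₂∈G₂ : All (mem G₂ ∘ proj₂) Q
  Q₂∈G₂ = All.map⁻ (All.++⁻ˡ _ (subst (All (mem G₂)) (≡.sym Q₂++drop≡bs) bs∈G₂))

  Q₁-free : ZeroSumFree (map proj₁ Q)
  Q₁-free = subst ZeroSumFree (≡.sym Q₁≡as) as-free
  Q₁-det : SumDetermined (map proj₁ Q)
  Q₁-det = subst SumDetermined (≡.sym Q₁≡as) as-det
  Q₂-free : ZeroSumFree (map proj₂ Q)
  Q₂-free = zeroSumFree-⊆ (subst (map proj₂ Q ⊆_) Q₂++drop≡bs (++⁺ʳ _ ⊆-refl)) bs-free
  Q₂-det : SumDetermined (map proj₂ Q)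
  Q₂-det = sumDetermined-++ˡ _ (subst SumDetermined (≡.sym Q₂++drop≡bs) bs-det)

  as⁻¹∈G₁ : All (mem G₁) (map _⁻¹ as)
  as⁻¹∈G₁ = All.map⁺ (All.map (⁻¹-mem G₁) as∈G₁)
  bs⁻¹∈G₂ : All (mem G₂) (map _⁻¹ bs)
  bs⁻¹∈G₂ = All.map⁺ (All.map (⁻¹-mem G₂) bs∈G₂)
  Q₁⁻¹∈G₁ : All (λ q → mem G₁ (proj₁ q ⁻¹)) Q
  Q₁⁻¹∈G₁ = All.map (⁻¹-mem G₁) Q₁∈G₁
  Q₂⁻¹∈G₂ : All (λ q → mem G₂ (proj₂ q ⁻¹)) Q
  Q₂⁻¹∈G₂ = All.map (⁻¹-mem G₂) Q₂∈G₂

  L₁-free : ZeroSumFree L₁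
  L₁-free = D₁₂.zeroSumFree-++ as∈G₁ bs∈G₂ as-free bs-free
  L₁-det : SumDetermined L₁
  L₁-det = D₁₂.sumDetermined-++ as∈G₁ bs∈G₂ as-det bs-det

  L₂-free : ZeroSumFree L₂
  L₂-free = D₁₂.zeroSumFree-++-map-∙ _ proj₂
    as⁻¹∈G₁ Q₁⁻¹∈G₁ Q₂∈G₂ (zeroSumFree-map⁻¹ as-free) Q₂-free
  L₂-det : SumDetermined L₂
  L₂-det = D₁₂.sumDetermined-++-map-∙ _ proj₂
    as⁻¹∈G₁ Q₁⁻¹∈G₁ Q₂∈G₂ (sumDetermined-map⁻¹ as-det) Q₂-det

  L₃-free : ZeroSumFree L₃
  L₃-free = D₂₁.zeroSumFree-++-map-∙ _ proj₁
    bs⁻¹∈G₂ Q₂⁻¹∈G₂ Q₁∈G₁ (zeroSumFree-map⁻¹ bs-free) Q₁-free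
  L₃-det : SumDetermined L₃
  L₃-det = D₂₁.sumDetermined-++-map-∙ _ proj₁
    bs⁻¹∈G₂ Q₂⁻¹∈G₂ Q₁∈G₁ (sumDetermined-map⁻¹ bs-det) Q₁-det

  block₁₂ block₁₃ : Carrier → Triple G
  block₁₂ x = ⟨ x ∷ [] , x ⁻¹ ∷ [] , [] ⟩
  block₁₃ x = ⟨ x ∷ [] , [] , x ⁻¹ ∷ [] ⟩

  block₂₃ : Carrier × Carrier → Triple G
  block₂₃ q = ⟨ [] , k₂ q ∷ [] , k₃ q ∷ [] ⟩

  block₁₂₃ : Triple G
  block₁₂₃ = ⟨ σ G L₁ ⁻¹ ∷ [] , σ G L₂ ⁻¹ ∷ [] , σ G L₃ ⁻¹ ∷ [] ⟩

  pairs : List (Triple G)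
  pairs = map block₁₂ as ++ map block₁₃ bs ++ map block₂₃ Q

  blocks : List (Triple G)
  blocks = block₁₂₃ ∷ pairs

  concatMap-pairs : (t : Triple G → List Carrier) → concatMap t pairs ≡
    concatMap (t ∘ block₁₂) as ++ concatMap (t ∘ block₁₃) bs ++ concatMap (t ∘ block₂₃) Q
  concatMap-pairs t =
    ≡.trans (concatMap-++ t (map block₁₂ as) _)
      (≡.cong₂ _++_ (concatMap-map t block₁₂ as)
        (≡.trans (concatMap-++ t (map block₁₃ bs) _)
          (≡.cong₂ _++_ (concatMap-map t block₁₃ bs) (concatMap-map t block₂₃ Q))))

  column₁ : concatMap Triple.t₁ blocks ≡ U₁
  column₁ = cong (σ G L₁ ⁻¹ ∷_) (≡.trans (concatMap-pairs Triple.t₁)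
    (≡.trans (≡.cong₂ _++_ (concatMap-pure as) (≡.cong₂ _++_ (concatMap-pure bs) (concatMap-[] Q)))
      (cong (as ++_) (++-identityʳ bs))))

  column₂ : concatMap Triple.t₂ blocks ≡ U₂
  column₂ = cong (σ G L₂ ⁻¹ ∷_) (≡.trans (concatMap-pairs Triple.t₂)
    (≡.cong₂ _++_ (concatMap-singleton _⁻¹ as)
      (≡.cong₂ _++_ (concatMap-[] bs) (concatMap-singleton k₂ Q))))

  column₃ : concatMap Triple.t₃ blocks ≡ U₃
  column₃ = cong (σ G L₃ ⁻¹ ∷_) (≡.trans (concatMap-pairs Triple.t₃)
    (≡.cong₂ _++_ (concatMap-[] as)
      (≡.cong₂ _++_ (concatMap-singleton _⁻¹ bs) (concatMap-singleton k₃ Q))))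

  k₂∙k₃≈ε : ∀ q → k₂ q ∙ k₃ q ≈ ε
  k₂∙k₃≈ε (x , y) = begin
    (x ⁻¹ ∙ y) ∙ (y ⁻¹ ∙ x)  ≈⟨ assoc _ _ _ ⟩
    x ⁻¹ ∙ (y ∙ (y ⁻¹ ∙ x))  ≈⟨ ∙-congˡ (sym (assoc _ _ _)) ⟩
    x ⁻¹ ∙ ((y ∙ y ⁻¹) ∙ x)  ≈⟨ ∙-congˡ (trans (∙-congʳ (inverseʳ y)) (identityˡ x)) ⟩
    x ⁻¹ ∙ x                 ≈⟨ inverseˡ x ⟩
    ε                        ∎
    where open import Relation.Binary.Reasoning.Setoid setoid

  block₂₃-atom : ∀ {q} → mem G₁ (proj₁ q) × mem G₂ (proj₂ q) × ¬ proj₂ q ≈ ε →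
                 IsAtom G (Wof G (block₂₃ q))
  block₂₃-atom {q} (x∈G₁ , y∈G₂ , y≉ε) = atom-pair (trans (∙-congˡ (identityʳ _)) (k₂∙k₃≈ε q))
    (λ e → y≉ε (proj₂ (D₁₂.components-zero (⁻¹-mem G₁ x∈G₁) y∈G₂ e)))

  pairs-atoms : All (λ t → IsAtom G (Wof G t)) pairs
  pairs-atoms =
    All.++⁺ (All.map⁺ (All.map atom-inverse-pair (zeroSumFree⇒nonzero as-free)))
      (All.++⁺ (All.map⁺ (All.map atom-inverse-pair (zeroSumFree⇒nonzero bs-free)))
        (All.map⁺ (All.zipWith block₂₃-atom
          (Q₁∈G₁ , All.zip (Q₂∈G₂ , All.map⁻ (zeroSumFree⇒nonzero Q₂-free))))))

  -- Double counting: the columns U₁, U₂, U₃ and all pair blocks are zero-sum,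
  -- hence so is the remaining block.
  block₁₂₃-zeroSum : ZeroSum G (Wof G block₁₂₃)
  block₁₂₃-zeroSum = begin
    σ G (Wof G block₁₂₃)
      ≈⟨ sym (identityʳ _) ⟩
    σ G (Wof G block₁₂₃) ∙ ε
      ≈⟨ ∙-congˡ (sym (σ-concat-zeroSum pairs-zeroSum)) ⟩
    σ G (Wof G block₁₂₃) ∙ σ G (concatMap (Wof G) pairs)
      ≈⟨ sym (σ-++ (Wof G block₁₂₃) (concatMap (Wof G) pairs)) ⟩
    σ G (concatMap (Wof G) blocks)
      ≈⟨ σ-concatMap-Wof blocks ⟩
    σ G (concatMap Triple.t₁ blocks) ∙
      (σ G (concatMap Triple.t₂ blocks) ∙ σ G (concatMap Triple.t₃ blocks))
      ≈⟨ ∙-cong (σ-column Triple.t₁ column₁)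
                (∙-cong (σ-column Triple.t₂ column₂) (σ-column Triple.t₃ column₃)) ⟩
    ε ∙ (ε ∙ ε)
      ≈⟨ trans (identityˡ _) (identityʳ ε) ⟩
    ε ∎
    where
    open import Relation.Binary.Reasoning.Setoid setoid
    pairs-zeroSum : All (ZeroSum G) (map (Wof G) pairs)
    pairs-zeroSum = All.map⁺ (All.map (proj₁ ∘ proj₂) pairs-atoms)
    σ-column : ∀ t {L} → concatMap t blocks ≡ σ G L ⁻¹ ∷ L → σ G (concatMap t blocks) ≈ ε
    σ-column _ e = trans (reflexive (cong (σ G) e)) (inverseˡ _)

  length-Q : length Q ≡ length as
  length-Q = ≡.trans (≡.sym (length-map proj₁ Q)) (cong length Q₁≡as)

  L₁≢[] : L₁ ≢ []
  L₁≢[] e = as≢[] (++-conicalˡ as bs e)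
  L₂≢[] : L₂ ≢ []
  L₂≢[] e = as≢[] (map≡[]⇒≡[] _⁻¹ (++-conicalˡ _ _ e))
  L₃≢[] : L₃ ≢ []
  L₃≢[] e =
    as≢[] (≡.trans (≡.sym Q₁≡as) (cong (map proj₁) (map≡[]⇒≡[] k₃ (++-conicalʳ _ _ e))))

  length-pairs : length pairs ≡ length as + (length bs + length as)
  length-pairs =
    ≡.trans (length-++ (map block₁₂ as))
      (≡.cong₂ _+_ (length-map block₁₂ as)
        (≡.trans (length-++ (map block₁₃ bs))
          (≡.cong₂ _+_ (length-map block₁₃ bs) (≡.trans (length-map block₂₃ Q) length-Q))))

  pairs-spread : All (λ t → spreadOf G t ≡ 2) pairs
  pairs-spread =
    All.++⁺ (All.map⁺ (All.universal (λ _ → refl) as))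
      (All.++⁺ (All.map⁺ (All.universal (λ _ → refl) bs)) (All.map⁺ (All.universal (λ _ → refl) Q)))

  ρ₃-witness : Σ (List ℕ) λ X →
    Rho3WithSpread G (suc (length as + (length bs + length as))) X × In23 X × v₃ X ≡ 1
  ρ₃-witness = map (spreadOf G) blocks ,
    ( U₁ , U₂ , U₃ , blocks
    , atom-∷ (inverseˡ _) L₁-free L₁-det
    , atom-∷ (inverseˡ _) L₂-free L₂-det
    , atom-∷ (inverseˡ _) L₃-free L₃-det
    , atom-triple block₁₂₃-zeroSum (⁻¹σ≉ε L₁-free L₁≢[]) (⁻¹σ≉ε L₂-free L₂≢[]) (⁻¹σ≉ε L₃-free L₃≢[])
        ∷ pairs-atoms
    , ↭-reflexive column₁ , ↭-reflexive column₂ , ↭-reflexive column₃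
    , ≤-reflexive (cong suc (≡.sym length-pairs))
    , refl )
    , 3∷all-2⇒In23×v₃≡1 (All.map⁺ pairs-spread)
    where open import Data.List.Relation.Binary.Permutation.Setoid setoid using (↭-reflexive)

2*[1+n]+[1+m]∸2≡1+n+[m+n] : ∀ n m → 2 * suc n + suc m ∸ 2 ≡ suc (n + (m + n))
2*[1+n]+[1+m]∸2≡1+n+[m+n] n m = cong (_∸ 2) (2*[1+n]+[1+m]≡2+[1+n+[m+n]] n m)
  where
  2*[1+n]+[1+m]≡2+[1+n+[m+n]] : ∀ n m → 2 * suc n + suc m ≡ 2 + suc (n + (m + n))
  2*[1+n]+[1+m]≡2+[1+n+[m+n]] = solve-∀

lemma4p4 : {c ℓ p : Level} (G : AbelianGroup c ℓ) → IsFiniteGroup G →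
    (G₁ G₂ : Subgroup G p) → IsDirectSum G G₁ G₂ →
    Nontrivial G G₁ → Nontrivial G G₂ →
    (d₁ d₂ : ℕ) → IsDavenport G G₁ d₁ → IsDavenport G G₂ d₂ → d₁ ≤ d₂ →
    Σ (List ℕ) λ X → Rho3WithSpread G (2 * d₁ + d₂ ∸ 2) X × In23 X × v₃ X ≡ 1
lemma4p4 G _ G₁ G₂ (_ , independent) (g , g∈G₁ , g≉ε) _ _ _
         ((a ∷ as , A-atom , _ ∷ as∈G₁ , refl) , D₁-bound) ((b ∷ bs , B-atom , _ ∷ bs∈G₂ , refl) , _)
         (s≤s as≤bs) =
  subst (λ ω → Σ (List ℕ) λ X → Rho3WithSpread G ω X × In23 X × v₃ X ≡ 1)
    (≡.sym (2*[1+n]+[1+m]∸2≡1+n+[m+n] (length as) (length bs)))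
    (Construction.ρ₃-witness G G₁ G₂ independent A-atom as∈G₁ B-atom bs∈G₂ as≢[] as≤bs)
  where
  open AbelianGroup G using (_⁻¹)
  as≢[] : as ≢ []
  as≢[] refl
    with D₁-bound (g ∷ g ⁻¹ ∷ []) (Sequences.atom-inverse-pair G g≉ε) (g∈G₁ ∷ ⁻¹-mem G₁ g∈G₁ ∷ [])
  ... | s≤s ()
lemma4p4 G _ _ _ _ _ _ _ _ (([] , ([]≢[] , _) , _) , _) _ _ = ⊥-elim ([]≢[] refl)
lemma4p4 G _ _ _ _ _ _ _ _ _ (([] , ([]≢[] , _) , _) , _) _ = ⊥-elim ([]≢[] refl)
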